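{- For any positive integers $a,b$ there is a tree $G$ with $sp(G)>a\left(\frac{|V(G)|}{\nu(G)}\right)^b$, where $\nu(G)$ is the size of a largest matching of $G$.
   Context: For a graph $G$ without isolated vertices, $sp(G)$ is the least integer $k$ such that $G$ has a subgraph $H$ with $V(H)=V(G)$ and $1\le d_H(x)\le k$ for all vertices $x$. -}

module Defs where

open import Data.Nat using (ℕ; zero; suc; _+_; _*_; _^_; _≤_; _<_)
open import Data.Bool using (Bool; true; false; if_then_else_; T)
open import Data.Fin using (Fin)
open import Data.List using (List; []; _∷_; _++_; length; map; allFin; take; concatMap)
open import Data.List.Relation.Unary.All using (All)
open import Data.List.Relation.Unary.Unique.Propositional using (Unique)
open import Data.Product using (Σ; ∃; _×_; _,_)
open import Data.Nat.ListAction using (sum)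
open import Data.Unit using (⊤)
open import Data.Empty using (⊥)
open import Relation.Binary.PropositionalEquality using (_≡_)

record Graph (n : ℕ) : Set where
  field
    adj    : Fin n → Fin n → Bool
    sym    : ∀ i j → adj i j ≡ adj j i
    irrefl : ∀ i → adj i i ≡ false
open Graph public

degree : ∀ {n} → Graph n → Fin n → ℕ
degree {n} G i = sum (map (λ j → if adj G i j then 1 else 0) (allFin n))

NoIsolatedVertices : ∀ {n} → Graph n → Set
NoIsolatedVertices {n} G = ∀ (i : Fin n) → 1 ≤ degree G i

SpanningSubgraph : ∀ {n} → Graph n → Graph n → Set
SpanningSubgraph {n} H G = ∀ (i j : Fin n) → T (adj H i j) → T (adj G i j)

Chain : ∀ {n} → Graph n → List (Fin n) → Set
Chain G [] = ⊤
Chain G (x ∷ []) = ⊤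
Chain G (x ∷ y ∷ r) = T (adj G x y) × Chain G (y ∷ r)

data Reach {n} (G : Graph n) : Fin n → Fin n → Set where
  here : ∀ {u} → Reach G u u
  step : ∀ {u w v} → T (adj G u w) → Reach G w v → Reach G u v

Connected : ∀ {n} → Graph n → Set
Connected {n} G = ∀ (u v : Fin n) → Reach G u v

IsCycle : ∀ {n} → Graph n → List (Fin n) → Set
IsCycle G vs = (3 ≤ length vs) × Unique vs × Chain G (vs ++ take 1 vs)

Acyclic : ∀ {n} → Graph n → Set
Acyclic {n} G = ∀ (vs : List (Fin n)) → IsCycle G vs → ⊥

IsTree : ∀ {n} → Graph n → Set
IsTree G = Connected G × Acyclic G

endpoints : ∀ {n} → List (Fin n × Fin n) → List (Fin n)
endpoints = concatMap (λ { (x , y) → x ∷ y ∷ [] })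

IsMatching : ∀ {n} → Graph n → List (Fin n × Fin n) → Set
IsMatching G M = All (λ { (x , y) → T (adj G x y) }) M × Unique (endpoints M)

MatchingNumber : ∀ {n} → Graph n → ℕ → Set
MatchingNumber {n} G m =
  (Σ (List (Fin n × Fin n)) λ M → IsMatching G M × length M ≡ m)
  × (∀ (M : List (Fin n × Fin n)) → IsMatching G M → length M ≤ m)

SpanBounded : ∀ {n} → Graph n → ℕ → Set
SpanBounded {n} G k =
  Σ (Graph n) λ H → SpanningSubgraph H G × (∀ (x : Fin n) → 1 ≤ degree H x × degree H x ≤ k)

Sp : ∀ {n} → Graph n → ℕ → Set
Sp G k = SpanBounded G k × (∀ k' → SpanBounded G k' → k ≤ k')

-- The witness is a spider with centre 0, k pendant leaves and k legs of length two,
-- k = a · 3ᵇ.  Its 3k + 1 vertices are labelled so that every vertex y hangs from its parent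
-- y ∸ 2k.  Every pendant leaf has the centre as its only neighbour, so a spanning subgraph
-- without isolated vertices contains all k pendant edges and sp = k; dropping the centre's
-- edges to the legs attains this.  The k + 1 vertices of index ≤ k cover all edges, so
-- ν ≤ k + 1, and a pendant edge plus one edge per leg is a matching of that size.  Finally
-- a (3k + 1)ᵇ < a 3ᵇ (k + 1)ᵇ = k (k + 1)ᵇ.
module Submission where

open import Defs hiding (sym)
open import Data.Nat using (ℕ; zero; suc; _+_; _*_; _^_; _∸_; _≤_; _<_; _<ᵇ_; _≡ᵇ_; z≤n; s≤s; s≤s⁻¹; _≤?_)
open import Data.Nat.Properties
  using ( ≤-refl; ≤-reflexive; ≤-trans; <-trans; <-asym; <-irrefl; <-cmp; <-≤-trans; ≤-<-trans
        ; <⇒≤; <⇒≢; <⇒≱; ≰⇒>; n<1+n; n≮0; <ᵇ⇒<; <⇒<ᵇ; ≡ᵇ⇒≡; ≡⇒≡ᵇ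
        ; +-comm; +-mono-≤; +-monoʳ-≤; m≤m+n; m≤n+m; m<m+n; m<n+m
        ; ∸-monoʳ-≤; ∸-monoˡ-≤; m∸n≤m; m+n∸m≡n; m+[n∸m]≡n; m≤n⇒m∸n≡0; m∸n≡0⇒m≤n; m∸n≢0⇒n<m
        ; *-assoc; *-mono-≤; *-monoʳ-<; *-commutativeSemigroup; ^-monoˡ-<; m^n>0; module ≤-Reasoning)
open import Data.Nat.ListAction using (sum)
open import Data.Nat.Tactic.RingSolver using (solve-∀)
open import Algebra.Properties.CommutativeSemigroup *-commutativeSemigroup using (interchange)
open import Data.Bool using (Bool; true; false; T; if_then_else_; _∧_; _∨_)
open import Data.Bool.Properties using (∨-comm; T-∧; T-∨)
open import Data.Fin using (Fin; zero; suc; toℕ; fromℕ<)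
open import Data.Fin.Properties using (toℕ-injective; toℕ-fromℕ<; toℕ<n; injective⇒≤)
import Data.Fin.Properties as Finₚ
open import Data.List using (List; []; _∷_; _++_; map; length; lookup; tabulate; allFin)
open import Data.List.Properties using (map-tabulate; length-map; length-tabulate)
open import Data.List.Relation.Unary.All as All using (All; []; _∷_)
open import Data.List.Relation.Unary.All.Properties using (tabulate⁺)
open import Data.List.Relation.Unary.AllPairs using ([]; _∷_)
open import Data.List.Relation.Unary.Any using (here; there)
open import Data.List.Relation.Unary.Unique.Propositional using (Unique)
open import Data.List.Membership.Propositional using (_∈_)
open import Data.List.Membership.Propositional.Properties using (∈-lookup)
open import Data.Product using (Σ; _×_; _,_; proj₁; proj₂)
open import Data.Sum using (_⊎_; inj₁; inj₂)
open import Data.Unit using (⊤; tt)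
open import Data.Empty using (⊥; ⊥-elim)
open import Function using (_∘_; id; flip; Equivalence)
open import Relation.Nullary using (¬_; contradiction; yes; no)
open import Relation.Binary using (tri<; tri≈; tri>)
open import Relation.Binary.PropositionalEquality
  using (_≡_; _≢_; refl; sym; trans; cong; subst; subst₂; ≢-sym; module ≡-Reasoning)

ind : Bool → ℕ
ind b = if b then 1 else 0

ind≤1 : ∀ b → ind b ≤ 1
ind≤1 true = ≤-refl
ind≤1 false = z≤n

ind-true : ∀ {b} → T b → ind b ≡ 1
ind-true {true} _ = refl

ind-false : ∀ {b} → ¬ T b → ind b ≡ 0
ind-false {true} ¬b = ⊥-elim (¬b tt)
ind-false {false} _ = refl

count : ∀ n → (Fin n → Bool) → ℕ
count n p = sum (map (ind ∘ p) (allFin n))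

count-suc : ∀ n (p : Fin (suc n) → Bool) → count (suc n) p ≡ ind (p zero) + count n (p ∘ suc)
count-suc n p = cong (λ xs → ind (p zero) + sum xs)
  (trans (map-tabulate suc (ind ∘ p)) (sym (map-tabulate id (ind ∘ p ∘ suc))))

count-skip : ∀ n (p : Fin (suc n) → Bool) → ¬ T (p zero) → count (suc n) p ≡ count n (p ∘ suc)
count-skip n p ¬p0 = trans (count-suc n p) (cong (_+ count n (p ∘ suc)) (ind-false ¬p0))

count-take : ∀ n (p : Fin (suc n) → Bool) → T (p zero) → count (suc n) p ≡ suc (count n (p ∘ suc))
count-take n p p0 = trans (count-suc n p) (cong (_+ count n (p ∘ suc)) (ind-true p0))

count-pos : ∀ n (p : Fin n → Bool) j → T (p j) → 1 ≤ count n p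
count-pos (suc n) p zero pj = subst (1 ≤_) (sym (count-take n p pj)) (s≤s z≤n)
count-pos (suc n) p (suc j) pj =
  subst (1 ≤_) (sym (count-suc n p)) (≤-trans (count-pos n (p ∘ suc) j pj) (m≤n+m _ _))

count-witness : ∀ n (p : Fin n → Bool) → 1 ≤ count n p → Σ (Fin n) λ j → T (p j)
count-witness (suc n) p h with p zero in eq | subst (1 ≤_) (count-suc n p) h
... | true  | _ = zero , subst T (sym eq) tt
... | false | h′ with j , pj ← count-witness n (p ∘ suc) h′ = suc j , pj

count-≤-interval : ∀ n (p : Fin n → Bool) m d →
  (∀ j → T (p j) → m ≤ toℕ j × toℕ j < m + d) → count n p ≤ d
count-≤-interval zero p m d inside = z≤n
count-≤-interval (suc n) p (suc m) d inside =
  subst (_≤ d) (sym (count-skip n p λ p0 → n≮0 (proj₁ (inside zero p0))))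
    (count-≤-interval n (p ∘ suc) m d λ j pj → let (lo , hi) = inside (suc j) pj in s≤s⁻¹ lo , s≤s⁻¹ hi)
count-≤-interval (suc n) p zero zero inside =
  subst (_≤ 0) (sym (count-skip n p λ p0 → n≮0 (proj₂ (inside zero p0))))
    (count-≤-interval n (p ∘ suc) zero zero λ j pj → ⊥-elim (n≮0 (proj₂ (inside (suc j) pj))))
count-≤-interval (suc n) p zero (suc d) inside =
  subst (_≤ suc d) (sym (count-suc n p))
    (+-mono-≤ (ind≤1 (p zero))
      (count-≤-interval n (p ∘ suc) zero d λ j pj → z≤n , s≤s⁻¹ (proj₂ (inside (suc j) pj))))

count-≥-interval : ∀ n (p : Fin n → Bool) m d → m + d ≤ n →
  (∀ j → m ≤ toℕ j → toℕ j < m + d → T (p j)) → d ≤ count n p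
count-≥-interval n p m zero _ _ = z≤n
count-≥-interval (suc n) p (suc m) (suc d) (s≤s fits) full =
  subst (suc d ≤_) (sym (count-suc n p))
    (≤-trans (count-≥-interval n (p ∘ suc) m (suc d) fits λ j lo hi → full (suc j) (s≤s lo) (s≤s hi))
             (m≤n+m _ _))
count-≥-interval (suc n) p zero (suc d) (s≤s fits) full =
  subst (suc d ≤_) (sym (count-take n p (full zero z≤n (s≤s z≤n))))
    (s≤s (count-≥-interval n (p ∘ suc) zero d fits λ j _ hi → full (suc j) z≤n (s≤s hi)))

count-≤-1 : ∀ n (p : Fin n → Bool) t → (∀ j → T (p j) → j ≡ t) → count n p ≤ 1
count-≤-1 n p t only-t = count-≤-interval n p (toℕ t) 1 λ j pj →
  let e = cong toℕ (only-t j pj)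
  in  ≤-reflexive (sym e) , subst (_< toℕ t + 1) (sym e) (m<m+n (toℕ t) (s≤s z≤n))

if-elim : ∀ {A : Set} (P : A → Set) b {x y} → (T b → P x) → (¬ T b → P y) → P (if b then x else y)
if-elim P true  px py = px tt
if-elim P false px py = py λ ()

unique⇒lookup-injective : ∀ {A : Set} {xs : List A} → Unique xs →
  ∀ {i j} → lookup xs i ≡ lookup xs j → i ≡ j
unique⇒lookup-injective (_ ∷ _) {zero} {zero} _ = refl
unique⇒lookup-injective (x∉ ∷ _) {zero} {suc j} e = contradiction e (All.lookup x∉ (∈-lookup j))
unique⇒lookup-injective (x∉ ∷ _) {suc i} {zero} e = contradiction (sym e) (All.lookup x∉ (∈-lookup i))
unique⇒lookup-injective (_ ∷ u) {suc i} {suc j} e = cong suc (unique⇒lookup-injective u e)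

unique-bounded-length : ∀ {n} c (xs : List (Fin n)) → Unique xs → All (λ v → toℕ v < c) xs →
  length xs ≤ c
unique-bounded-length c xs u bounded = injective⇒≤ {f = code} code-injective
  where
  code : Fin (length xs) → Fin c
  code i = fromℕ< (All.lookup bounded (∈-lookup i))
  code-injective : ∀ {i j} → code i ≡ code j → i ≡ j
  code-injective {i} {j} e = unique⇒lookup-injective u (toℕ-injective (begin
    toℕ (lookup xs i) ≡⟨ toℕ-fromℕ< _ ⟨
    toℕ (code i)      ≡⟨ cong toℕ e ⟩
    toℕ (code j)      ≡⟨ toℕ-fromℕ< _ ⟩
    toℕ (lookup xs j) ∎))
    where open ≡-Reasoning

-- A matching cannot be larger than a vertex cover; here the cover is {v : toℕ v < c}.
module _ {n} (G : Graph n) (c : ℕ) (covered : ∀ x y → T (adj G x y) → toℕ x < c ⊎ toℕ y < c) where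

  coveredEnd : Fin n × Fin n → Fin n
  coveredEnd (x , y) = if toℕ x <ᵇ c then x else y

  coveredEnd-covered : ∀ x y → T (adj G x y) → toℕ (coveredEnd (x , y)) < c
  coveredEnd-covered x y xy = if-elim (λ v → toℕ v < c) (toℕ x <ᵇ c) (<ᵇ⇒< _ _) λ x≮c →
    case-y (covered x y xy) x≮c
    where
    case-y : toℕ x < c ⊎ toℕ y < c → ¬ T (toℕ x <ᵇ c) → toℕ y < c
    case-y (inj₁ x<c) x≮c = contradiction (<⇒<ᵇ x<c) x≮c
    case-y (inj₂ y<c) _   = y<c

  coveredEnds-avoid : ∀ v M → All (v ≢_) (endpoints M) → All (v ≢_) (map coveredEnd M)
  coveredEnds-avoid v [] _ = []
  coveredEnds-avoid v ((x , y) ∷ M) (v≢x ∷ v≢y ∷ rest) =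
    if-elim (v ≢_) (toℕ x <ᵇ c) (λ _ → v≢x) (λ _ → v≢y) ∷ coveredEnds-avoid v M rest

  coveredEnds-unique : ∀ M → Unique (endpoints M) → Unique (map coveredEnd M)
  coveredEnds-unique [] _ = []
  coveredEnds-unique ((x , y) ∷ M) ((_ ∷ x∉) ∷ y∉ ∷ u) =
    if-elim (λ v → All (v ≢_) (map coveredEnd M)) (toℕ x <ᵇ c)
      (λ _ → coveredEnds-avoid x M x∉) (λ _ → coveredEnds-avoid y M y∉)
    ∷ coveredEnds-unique M u

  matching-≤-cover : ∀ M → IsMatching G M → length M ≤ c
  matching-≤-cover M (edges , u) = subst (_≤ c) (length-map coveredEnd M)
    (unique-bounded-length c (map coveredEnd M) (coveredEnds-unique M u) (ends-covered M edges))
    where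
    ends-covered : ∀ M → All (λ { (x , y) → T (adj G x y) }) M → All (λ v → toℕ v < c) (map coveredEnd M)
    ends-covered [] [] = []
    ends-covered ((x , y) ∷ M) (xy ∷ edges) = coveredEnd-covered x y xy ∷ ends-covered M edges

endpoints-tabulate⁺ : ∀ {n m} {P : Fin n → Set} (lo hi : Fin m → Fin n) →
  (∀ i → P (lo i)) → (∀ i → P (hi i)) → All P (endpoints (tabulate (λ i → lo i , hi i)))
endpoints-tabulate⁺ {m = zero}  lo hi plo phi = []
endpoints-tabulate⁺ {m = suc m} lo hi plo phi =
  plo zero ∷ phi zero ∷ endpoints-tabulate⁺ (lo ∘ suc) (hi ∘ suc) (plo ∘ suc) (phi ∘ suc)

tabulated-unique : ∀ {n} m (lo hi : Fin m → Fin n) →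
  (∀ {i j} → lo i ≡ lo j → i ≡ j) → (∀ {i j} → hi i ≡ hi j → i ≡ j) → (∀ i j → lo i ≢ hi j) →
  Unique (endpoints (tabulate (λ i → lo i , hi i)))
tabulated-unique zero lo hi _ _ _ = []
tabulated-unique (suc m) lo hi lo-inj hi-inj apart =
  (apart zero zero ∷ endpoints-tabulate⁺ (lo ∘ suc) (hi ∘ suc)
                       (λ i e → Finₚ.0≢1+n (lo-inj e)) (λ i → apart zero (suc i)))
  ∷ endpoints-tabulate⁺ (lo ∘ suc) (hi ∘ suc)
      (λ i e → apart (suc i) zero (sym e)) (λ i e → Finₚ.0≢1+n (hi-inj e))
  ∷ tabulated-unique m (lo ∘ suc) (hi ∘ suc)
      (Finₚ.suc-injective ∘ lo-inj) (Finₚ.suc-injective ∘ hi-inj) (λ i j → apart (suc i) (suc j))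

tabulated-matching : ∀ {n} (G : Graph n) m (lo hi : Fin m → Fin n) →
  (∀ i → T (adj G (lo i) (hi i))) →
  (∀ {i j} → lo i ≡ lo j → i ≡ j) → (∀ {i j} → hi i ≡ hi j → i ≡ j) → (∀ i j → lo i ≢ hi j) →
  IsMatching G (tabulate (λ i → lo i , hi i))
tabulated-matching G m lo hi edges lo-inj hi-inj apart =
  tabulate⁺ edges , tabulated-unique m lo hi lo-inj hi-inj apart

adj-sym : ∀ {n} (G : Graph n) {x y} → T (adj G x y) → T (adj G y x)
adj-sym G {x} {y} = subst T (Graph.sym G x y)

reach-trans : ∀ {n} {G : Graph n} {u w v} → Reach G u w → Reach G w v → Reach G u v
reach-trans here      r = r
reach-trans (step e p) r = step e (reach-trans p r)

reach-sym : ∀ {n} {G : Graph n} {u v} → Reach G u v → Reach G v u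
reach-sym here = here
reach-sym {G = G} (step e p) = reach-trans (reach-sym p) (step (adj-sym G e) here)

connected-via-root : ∀ {n} (G : Graph n) r → (∀ u → Reach G u r) → Connected G
connected-via-root G r to-root u v = reach-trans (to-root u) (reach-sym (to-root v))

_≺_ : ∀ {n} → Fin n → Fin n → Set
x ≺ y = toℕ x < toℕ y

adj-≺ : ∀ {n} (G : Graph n) {x y} → T (adj G x y) → x ≺ y ⊎ y ≺ x
adj-≺ G {x} {y} xy with <-cmp (toℕ x) (toℕ y)
... | tri< x≺y _ _ = inj₁ x≺y
... | tri≈ _ x≡y _ = ⊥-elim (subst T (trans (cong (adj G x) (sym (toℕ-injective x≡y))) (irrefl G x)) xy)
... | tri> _ _ y≺x = inj₂ y≺x

-- Going once around a cycle v₀ v₁ … vₖ v₀ never backtracks, and a non-backtracking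
-- walk that steps up once keeps stepping up.  So the walk can neither start upwards nor
-- (read backwards) end downwards at v₀; hence v₁ and vₖ are two lower neighbours of v₀.
module LowerNeighbourUnique {n} (G : Graph n)
  (lower-unique : ∀ x y z → T (adj G x y) → T (adj G x z) → y ≺ x → z ≺ x → y ≡ z) where

  NonBacktracking : List (Fin n) → Set
  NonBacktracking (x ∷ y ∷ z ∷ r) = x ≢ z × NonBacktracking (y ∷ z ∷ r)
  NonBacktracking _ = ⊤

  lastOf : Fin n → List (Fin n) → Fin n
  lastOf x []      = x
  lastOf x (y ∷ r) = lastOf y r

  LastStep : (Fin n → Fin n → Set) → Fin n → Fin n → List (Fin n) → Set
  LastStep R x y []      = R x y
  LastStep R x y (z ∷ r) = LastStep R y z r

  last-step-not-both : ∀ x y r → LastStep _≺_ x y r → LastStep (flip _≺_) x y r → ⊥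
  last-step-not-both x y []      up down = <-asym up down
  last-step-not-both x y (z ∷ r) up down = last-step-not-both y z r up down

  climb : ∀ x y r → Chain G (x ∷ y ∷ r) → NonBacktracking (x ∷ y ∷ r) → x ≺ y →
          x ≺ lastOf y r × LastStep _≺_ x y r
  climb x y []      _ _ x≺y = x≺y , x≺y
  climb x y (z ∷ r) (xy , yz , chain) (x≢z , nb) x≺y with adj-≺ G yz
  ... | inj₂ z≺y = contradiction (lower-unique y x z (adj-sym G xy) yz x≺y z≺y) x≢z
  ... | inj₁ y≺z with climb y z r (yz , chain) nb y≺z
  ...   | y≺last , up = <-trans x≺y y≺last , up

  descend : ∀ x y r → Chain G (x ∷ y ∷ r) → NonBacktracking (x ∷ y ∷ r) →
            LastStep (flip _≺_) x y r → lastOf y r ≺ x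
  descend x y []      _ _ y≺x = y≺x
  descend x y (z ∷ r) (xy , chain) (x≢z , nb) down with adj-≺ G xy
  ... | inj₁ x≺y = ⊥-elim (last-step-not-both y z r
                     (proj₂ (climb x y (z ∷ r) (xy , chain) (x≢z , nb) x≺y)) down)
  ... | inj₂ y≺x = <-trans (descend y z r chain nb down) y≺x

  lastOf-snoc : ∀ x r v → lastOf x (r ++ v ∷ []) ≡ v
  lastOf-snoc x []      v = refl
  lastOf-snoc x (y ∷ r) v = lastOf-snoc y r v

  lastOf-∈ : ∀ x r → lastOf x r ∈ x ∷ r
  lastOf-∈ x []      = here refl
  lastOf-∈ x (y ∷ r) = there (lastOf-∈ y r)

  chain-last : ∀ x r v → Chain G (x ∷ r ++ v ∷ []) → T (adj G (lastOf x r) v)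
  chain-last x []      v (xv , _)    = xv
  chain-last x (y ∷ r) v (_ , chain) = chain-last y r v chain

  last-step-snoc : ∀ R x y r v → R (lastOf y r) v → LastStep R x y (r ++ v ∷ [])
  last-step-snoc R x y []      v rv = rv
  last-step-snoc R x y (z ∷ r) v rv = last-step-snoc R y z r v rv

  closed-non-backtracking : ∀ a b c w v → Unique (a ∷ b ∷ c ∷ w) → All (_≢ v) (b ∷ c ∷ w) →
                            NonBacktracking (a ∷ b ∷ c ∷ w ++ v ∷ [])
  closed-non-backtracking a b c []      v ((_ ∷ a≢c ∷ []) ∷ _) (b≢v ∷ _) = a≢c , b≢v , tt
  closed-non-backtracking a b c (d ∷ w) v ((_ ∷ a≢c ∷ _) ∷ u) (_ ∷ rest) =
    a≢c , closed-non-backtracking b c d w v u rest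

  cycle-non-backtracking : ∀ a b c w → Unique (a ∷ b ∷ c ∷ w) →
                           NonBacktracking (a ∷ b ∷ c ∷ w ++ a ∷ [])
  cycle-non-backtracking a b c w u@(a∉ ∷ _) = closed-non-backtracking a b c w a u (All.map ≢-sym a∉)

  acyclic : Acyclic G
  acyclic []              (() , _)
  acyclic (_ ∷ [])        (s≤s () , _)
  acyclic (_ ∷ _ ∷ [])    (s≤s (s≤s ()) , _)
  acyclic (v₀ ∷ v₁ ∷ v₂ ∷ r) (_ , u@(_ ∷ v₁∉ ∷ _) , chain@(v₀v₁ , closing))
    with adj-≺ G v₀v₁
  ... | inj₁ v₀≺v₁ =
    <-irrefl (cong toℕ (sym (lastOf-snoc v₁ (v₂ ∷ r) v₀)))
      (proj₁ (climb v₀ v₁ _ chain (cycle-non-backtracking v₀ v₁ v₂ r u) v₀≺v₁))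
  ... | inj₂ v₁≺v₀ with adj-≺ G (chain-last v₁ (v₂ ∷ r) v₀ closing)
  ...   | inj₁ vₖ≺v₀ = contradiction (lower-unique v₀ v₁ (lastOf v₂ r) v₀v₁
                          (adj-sym G (chain-last v₁ (v₂ ∷ r) v₀ closing)) v₁≺v₀ vₖ≺v₀)
                          (All.lookup v₁∉ (lastOf-∈ v₂ r))
  ...   | inj₂ v₀≺vₖ = <-irrefl (cong toℕ (lastOf-snoc v₁ (v₂ ∷ r) v₀))
                          (descend v₀ v₁ _ chain (cycle-non-backtracking v₀ v₁ v₂ r u)
                            (last-step-snoc (flip _≺_) v₁ v₂ r v₀ v₀≺vₖ))

<ᵇ-irrefl : ∀ x → (x <ᵇ x) ≡ false
<ᵇ-irrefl zero    = refl
<ᵇ-irrefl (suc x) = <ᵇ-irrefl x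

DownEdge : (ℕ → ℕ → Bool) → ℕ → ℕ → Set
DownEdge D x y = y < x × T (D x y)

edgeᵇ : (ℕ → ℕ → Bool) → ℕ → ℕ → Bool
edgeᵇ D x y = ((y <ᵇ x) ∧ D x y) ∨ ((x <ᵇ y) ∧ D y x)

edgeᵇ⁻ : ∀ D x y → T (edgeᵇ D x y) → DownEdge D x y ⊎ DownEdge D y x
edgeᵇ⁻ D x y xy with Equivalence.to T-∨ xy
... | inj₁ down = let (y<x , dxy) = Equivalence.to T-∧ down in inj₁ (<ᵇ⇒< y x y<x , dxy)
... | inj₂ up   = let (x<y , dyx) = Equivalence.to T-∧ up   in inj₂ (<ᵇ⇒< x y x<y , dyx)

edgeᵇ-down : ∀ D x y → DownEdge D x y → T (edgeᵇ D x y)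
edgeᵇ-down D x y (y<x , dxy) = Equivalence.from T-∨ (inj₁ (Equivalence.from T-∧ (<⇒<ᵇ y<x , dxy)))

edgeᵇ-up : ∀ D x y → DownEdge D y x → T (edgeᵇ D x y)
edgeᵇ-up D x y (x<y , dyx) = Equivalence.from T-∨ (inj₂ (Equivalence.from T-∧ (<⇒<ᵇ x<y , dyx)))

downGraph : (ℕ → ℕ → Bool) → ∀ n → Graph n
downGraph D n = record
  { adj    = λ i j → edgeᵇ D (toℕ i) (toℕ j)
  ; sym    = λ i j → ∨-comm ((toℕ j <ᵇ toℕ i) ∧ D (toℕ i) (toℕ j)) _
  ; irrefl = λ i → let d = D (toℕ i) (toℕ i) in cong (λ b → (b ∧ d) ∨ (b ∧ d)) (<ᵇ-irrefl (toℕ i))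
  }

downGraph-mono : ∀ (D D′ : ℕ → ℕ → Bool) n → (∀ x y → T (D′ x y) → T (D x y)) →
  SpanningSubgraph (downGraph D′ n) (downGraph D n)
downGraph-mono D D′ n D′⊆D i j ij with edgeᵇ⁻ D′ (toℕ i) (toℕ j) ij
... | inj₁ (j<i , d) = edgeᵇ-down D (toℕ i) (toℕ j) (j<i , D′⊆D _ _ d)
... | inj₂ (i<j , d) = edgeᵇ-up   D (toℕ i) (toℕ j) (i<j , D′⊆D _ _ d)

downGraph-acyclic : ∀ D n → (∀ x y z → T (D x y) → T (D x z) → y ≡ z) → Acyclic (downGraph D n)
downGraph-acyclic D n functional = LowerNeighbourUnique.acyclic (downGraph D n) lower-unique
  where
  below : ∀ x y → T (edgeᵇ D x y) → y < x → T (D x y)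
  below x y xy y<x with edgeᵇ⁻ D x y xy
  ... | inj₁ (_ , dxy) = dxy
  ... | inj₂ (x<y , _) = ⊥-elim (<-asym x<y y<x)
  lower-unique : ∀ x y z → T (edgeᵇ D (toℕ x) (toℕ y)) → T (edgeᵇ D (toℕ x) (toℕ z)) →
                 y ≺ x → z ≺ x → y ≡ z
  lower-unique x y z xy xz y≺x z≺x =
    toℕ-injective (functional _ _ _ (below _ _ xy y≺x) (below _ _ xz z≺x))

-- If every vertex other than 0 has a downward edge to a vertex, downGraph D is connected:
-- following downward edges always reaches the root 0.
downGraph-connected : ∀ D m → (∀ (x : Fin (suc m)) → 0 < toℕ x →
  Σ (Fin (suc m)) λ y → DownEdge D (toℕ x) (toℕ y)) → Connected (downGraph D (suc m))
downGraph-connected D m descent = connected-via-root (downGraph D (suc m)) zero λ x →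
  to-root (toℕ x) x ≤-refl
  where
  to-root : ∀ b (x : Fin (suc m)) → toℕ x ≤ b → Reach (downGraph D (suc m)) x zero
  to-root b zero _ = here
  to-root zero (suc x) ()
  to-root (suc b) x@(suc _) x≤b with descent x (s≤s z≤n)
  ... | y , y<x , dxy = step (edgeᵇ-down D (toℕ x) (toℕ y) (y<x , dxy))
                             (to-root b y (s≤s⁻¹ (≤-trans y<x x≤b)))

forced-edge : ∀ {n} (H G : Graph n) x y → SpanningSubgraph H G → 1 ≤ degree H y →
  (∀ j → T (adj G y j) → j ≡ x) → T (adj H x y)
forced-edge {n} H G x y H⊆G y-covered only-x
  with j , yj ← count-witness n (adj H y) y-covered
  = adj-sym H (subst (T ∘ adj H y) (only-x j (H⊆G y j yj)) yj)

spanning-no-isolated : ∀ {n} (H G : Graph n) → SpanningSubgraph H G → NoIsolatedVertices H →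
  NoIsolatedVertices G
spanning-no-isolated {n} H G H⊆G H-covers x
  with j , xj ← count-witness n (adj H x) (H-covers x)
  = count-pos n (adj G x) j (H⊆G x j xj)

-- The spider with centre 0, inner vertices 1 … k, pendant leaves k+1 … 2k attached to the
-- centre, and outer leaves 2k+1 … 3k, where 2k+i hangs from the inner vertex i.
module Spider (k : ℕ) (k≥1 : 1 ≤ k) where

  K2 : ℕ
  K2 = k + k

  -- The largest vertex index; the spider has N + 1 vertices.
  N : ℕ
  N = K2 + k

  parent : ℕ → ℕ
  parent y = y ∸ K2

  -- Hangs x y: x hangs from y in the spider.  HangsKept x y: the same, in the optimal
  -- spanning subgraph, which omits the edges from the inner vertices to the centre.
  Hangs HangsKept : ℕ → ℕ → Bool
  Hangs x y = parent x ≡ᵇ y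
  HangsKept x y = (k <ᵇ x) ∧ Hangs x y

  spider : Graph (suc N)
  spider = downGraph Hangs (suc N)

  optimal : Graph (suc N)
  optimal = downGraph HangsKept (suc N)

  K2≥1 : 1 ≤ K2
  K2≥1 = ≤-trans k≥1 (m≤m+n k k)

  parent-< : ∀ y → 1 ≤ y → parent y < y
  parent-< (suc y) _ = s≤s (∸-monoʳ-≤ (suc y) K2≥1)

  parent-≤ : ∀ y → y ≤ N → parent y ≤ k
  parent-≤ y y≤N = subst (parent y ≤_) (m+n∸m≡n K2 k) (∸-monoˡ-≤ K2 y≤N)

  parent-low : ∀ y → y ≤ K2 → parent y ≡ 0
  parent-low y = m≤n⇒m∸n≡0

  parent-high : ∀ i → parent (K2 + i) ≡ i
  parent-high = m+n∸m≡n K2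

  parent-inv : ∀ y i → 1 ≤ i → parent y ≡ i → y ≡ K2 + i
  parent-inv y i i≥1 e = begin
    y                 ≡⟨ m+[n∸m]≡n K2≤y ⟨
    K2 + (y ∸ K2)     ≡⟨ cong (K2 +_) e ⟩
    K2 + i            ∎
    where
    open ≡-Reasoning
    K2≤y : K2 ≤ y
    K2≤y = <⇒≤ (m∸n≢0⇒n<m λ e′ → <⇒≢ i≥1 (trans (sym e′) e))

  hangs⇒parent : ∀ {x y} → T (Hangs x y) → parent x ≡ y
  hangs⇒parent {x} {y} = ≡ᵇ⇒≡ (parent x) y

  parent⇒hangs : ∀ {x y} → parent x ≡ y → T (Hangs x y)
  parent⇒hangs {x} {y} = ≡⇒≡ᵇ (parent x) y

  k<K2 : k < K2
  k<K2 = m<m+n k k≥1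

  -- Only the inner vertices (at most k) have children, so no vertex beyond k has one.
  no-child : ∀ x j → k < x → j ≤ N → ¬ T (Hangs j x)
  no-child x j k<x j≤N h = <⇒≱ k<x (subst (_≤ k) (hangs⇒parent h) (parent-≤ j j≤N))

  kept⇒hangs : ∀ x y → T (HangsKept x y) → T (Hangs x y)
  kept⇒hangs x y = proj₂ ∘ Equivalence.to T-∧

  kept⇒outer : ∀ x y → T (HangsKept x y) → k < x
  kept⇒outer x y = <ᵇ⇒< k x ∘ proj₁ ∘ Equivalence.to T-∧

  centre-optimal-nbr : ∀ j → T (edgeᵇ HangsKept 0 j) → suc k ≤ j × j < suc k + k
  centre-optimal-nbr j e with edgeᵇ⁻ HangsKept 0 j e
  ... | inj₁ (() , _)
  ... | inj₂ (_ , d) = kept⇒outer j 0 d , s≤s (m∸n≡0⇒m≤n (hangs⇒parent (kept⇒hangs j 0 d)))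

  inner-optimal-nbr : ∀ x j → 1 ≤ x → x ≤ k → T (edgeᵇ HangsKept x j) → j ≡ K2 + x
  inner-optimal-nbr x j x≥1 x≤k e with edgeᵇ⁻ HangsKept x j e
  ... | inj₁ (_ , d) = contradiction x≤k (<⇒≱ (kept⇒outer x j d))
  ... | inj₂ (_ , d) = parent-inv j x x≥1 (hangs⇒parent (kept⇒hangs j x d))

  outer-optimal-nbr : ∀ x j → k < x → j ≤ N → T (edgeᵇ HangsKept x j) → j ≡ parent x
  outer-optimal-nbr x j k<x j≤N e with edgeᵇ⁻ HangsKept x j e
  ... | inj₁ (_ , d) = sym (hangs⇒parent (kept⇒hangs x j d))
  ... | inj₂ (_ , d) = contradiction (kept⇒hangs j x d) (no-child x j k<x j≤N)

  pendant-nbr : ∀ ℓ j → k < ℓ → ℓ ≤ K2 → j ≤ N → T (edgeᵇ Hangs ℓ j) → j ≡ 0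
  pendant-nbr ℓ j k<ℓ ℓ≤K2 j≤N e with edgeᵇ⁻ Hangs ℓ j e
  ... | inj₁ (_ , d) = trans (sym (hangs⇒parent d)) (parent-low ℓ ℓ≤K2)
  ... | inj₂ (_ , d) = contradiction d (no-child ℓ j k<ℓ j≤N)

  spider-covered : ∀ x y → x ≤ N → y ≤ N → T (edgeᵇ Hangs x y) → x < suc k ⊎ y < suc k
  spider-covered x y x≤N y≤N e with edgeᵇ⁻ Hangs x y e
  ... | inj₁ (_ , d) = inj₂ (s≤s (subst (_≤ k) (hangs⇒parent d) (parent-≤ x x≤N)))
  ... | inj₂ (_ , d) = inj₁ (s≤s (subst (_≤ k) (hangs⇒parent d) (parent-≤ y y≤N)))

  suc-k≤K2 : suc k ≤ K2
  suc-k≤K2 = subst (_≤ K2) (+-comm k 1) (+-monoʳ-≤ k k≥1)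

  suc-k≤N : suc k ≤ N
  suc-k≤N = ≤-trans suc-k≤K2 (m≤m+n K2 k)

  vertex : ∀ t → t ≤ N → Fin (suc N)
  vertex t t≤N = fromℕ< (s≤s t≤N)

  toℕ-vertex : ∀ {t} (t≤N : t ≤ N) → toℕ (vertex t t≤N) ≡ t
  toℕ-vertex t≤N = toℕ-fromℕ< (s≤s t≤N)

  index≤N : ∀ (x : Fin (suc N)) → toℕ x ≤ N
  index≤N x = s≤s⁻¹ (toℕ<n x)

  parent≤N : ∀ (x : Fin (suc N)) → parent (toℕ x) ≤ N
  parent≤N x = ≤-trans (m∸n≤m (toℕ x) K2) (index≤N x)

  vertex-injective : ∀ {s t} (s≤N : s ≤ N) (t≤N : t ≤ N) → vertex s s≤N ≡ vertex t t≤N → s ≡ t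
  vertex-injective s≤N t≤N e = trans (sym (toℕ-vertex s≤N)) (trans (cong toℕ e) (toℕ-vertex t≤N))

  ≡-vertex : ∀ (j : Fin (suc N)) {t} (t≤N : t ≤ N) → toℕ j ≡ t → j ≡ vertex t t≤N
  ≡-vertex j t≤N e = toℕ-injective (trans e (sym (toℕ-vertex t≤N)))

  adj-vertex : ∀ D (x : Fin (suc N)) {t} (t≤N : t ≤ N) → T (edgeᵇ D (toℕ x) t) →
    T (adj (downGraph D (suc N)) x (vertex t t≤N))
  adj-vertex D x t≤N = subst (T ∘ edgeᵇ D (toℕ x)) (sym (toℕ-vertex t≤N))

  -- Every vertex hangs from a unique parent of smaller index, so the spider is a tree.
  spider-tree : IsTree spider
  spider-tree = downGraph-connected Hangs N to-parent
              , downGraph-acyclic Hangs (suc N) λ x y z dy dz →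
                  trans (sym (hangs⇒parent dy)) (hangs⇒parent dz)
    where
    to-parent : ∀ x → 0 < toℕ x → Σ (Fin (suc N)) λ y → DownEdge Hangs (toℕ x) (toℕ y)
    to-parent x x≥1 = vertex (parent (toℕ x)) (parent≤N x)
                    , subst (DownEdge Hangs (toℕ x)) (sym (toℕ-vertex (parent≤N x)))
                        (parent-< (toℕ x) x≥1 , parent⇒hangs refl)

  optimal-spanning : SpanningSubgraph optimal spider
  optimal-spanning = downGraph-mono Hangs HangsKept (suc N) kept⇒hangs

  optimal-unique-nbr : ∀ x → 1 ≤ toℕ x →
    Σ (Fin (suc N)) λ y → T (adj optimal x y) × (∀ j → T (adj optimal x j) → j ≡ y)
  optimal-unique-nbr x x≥1 with toℕ x ≤? k
  ... | yes x≤k = vertex (K2 + toℕ x) outer≤N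
                , adj-vertex HangsKept x outer≤N (edgeᵇ-up HangsKept (toℕ x) (K2 + toℕ x)
                    (m<n+m (toℕ x) K2≥1
                    , Equivalence.from T-∧ (<⇒<ᵇ (<-≤-trans k<K2 (m≤m+n K2 (toℕ x)))
                                          , parent⇒hangs (parent-high (toℕ x)))))
                , λ j e → ≡-vertex j outer≤N (inner-optimal-nbr (toℕ x) (toℕ j) x≥1 x≤k e)
    where
    outer≤N : K2 + toℕ x ≤ N
    outer≤N = +-monoʳ-≤ K2 x≤k
  ... | no x≰k = vertex (parent (toℕ x)) (parent≤N x)
               , adj-vertex HangsKept x (parent≤N x)
                   (edgeᵇ-down HangsKept (toℕ x) (parent (toℕ x))
                     (parent-< (toℕ x) x≥1 , Equivalence.from T-∧ (<⇒<ᵇ (≰⇒> x≰k) , parent⇒hangs refl)))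
               , λ j e → ≡-vertex j (parent≤N x)
                           (outer-optimal-nbr (toℕ x) (toℕ j) (≰⇒> x≰k) (index≤N j) e)

  optimal-degree : ∀ x → 1 ≤ degree optimal x × degree optimal x ≤ k
  optimal-degree zero =
      count-pos (suc N) (adj optimal zero) (vertex (suc k) suc-k≤N)
        (adj-vertex HangsKept zero suc-k≤N (edgeᵇ-up HangsKept 0 (suc k)
          (s≤s z≤n , Equivalence.from T-∧
                       (<⇒<ᵇ (n<1+n k) , parent⇒hangs (parent-low (suc k) suc-k≤K2)))))
    , count-≤-interval (suc N) (adj optimal zero) (suc k) k λ j → centre-optimal-nbr (toℕ j)
  optimal-degree x@(suc _) with y , xy , only-y ← optimal-unique-nbr x (s≤s z≤n) =
    count-pos (suc N) (adj optimal x) y xy , ≤-trans (count-≤-1 (suc N) (adj optimal x) y only-y) k≥1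

  spider-no-isolated : NoIsolatedVertices spider
  spider-no-isolated = spanning-no-isolated optimal spider optimal-spanning (proj₁ ∘ optimal-degree)

  -- sp(spider) = k: the optimal subgraph attains k, and any spanning subgraph without
  -- isolated vertices contains all k edges from the centre to the pendant leaves.
  spider-sp : Sp spider k
  spider-sp = (optimal , optimal-spanning , optimal-degree) , minimal
    where
    minimal : ∀ k′ → SpanBounded spider k′ → k ≤ k′
    minimal k′ (H , H⊆spider , H-degree) =
      ≤-trans (count-≥-interval (suc N) (adj H zero) (suc k) k (s≤s (m≤m+n K2 k)) pendant-kept)
              (proj₂ (H-degree zero))
      where
      pendant-kept : ∀ ℓ → suc k ≤ toℕ ℓ → toℕ ℓ < suc k + k → T (adj H zero ℓ)
      pendant-kept ℓ k<ℓ ℓ<2k+1 = forced-edge H spider zero ℓ H⊆spider (proj₁ (H-degree ℓ)) λ j e →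
        toℕ-injective (pendant-nbr (toℕ ℓ) (toℕ j) k<ℓ (s≤s⁻¹ ℓ<2k+1) (index≤N j) e)

  partner : ℕ → ℕ
  partner zero    = suc k
  partner (suc i) = K2 + suc i

  parent-partner : ∀ i → parent (partner i) ≡ i
  parent-partner zero    = parent-low (suc k) suc-k≤K2
  parent-partner (suc i) = parent-high (suc i)

  k<partner : ∀ i → k < partner i
  k<partner zero    = ≤-refl
  k<partner (suc i) = <-≤-trans k<K2 (m≤m+n K2 (suc i))

  partner≤N : ∀ i → i ≤ k → partner i ≤ N
  partner≤N zero    _   = suc-k≤N
  partner≤N (suc i) i≤k = +-monoʳ-≤ K2 i≤k

  spider-matching : MatchingNumber spider (suc k)
  spider-matching =
      (tabulate (λ i → low i , high i)
      , tabulated-matching spider (suc k) low high edge low-injective high-injective apart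
      , length-tabulate (λ i → low i , high i))
    , matching-≤-cover spider (suc k) λ x y → spider-covered (toℕ x) (toℕ y) (index≤N x) (index≤N y)
    where
    i≤k : ∀ (i : Fin (suc k)) → toℕ i ≤ k
    i≤k i = s≤s⁻¹ (toℕ<n i)
    low≤N : ∀ i → toℕ i ≤ N
    low≤N i = ≤-trans (i≤k i) (<⇒≤ suc-k≤N)
    high≤N : ∀ i → partner (toℕ i) ≤ N
    high≤N i = partner≤N (toℕ i) (i≤k i)
    low high : Fin (suc k) → Fin (suc N)
    low i  = vertex (toℕ i) (low≤N i)
    high i = vertex (partner (toℕ i)) (high≤N i)
    edge : ∀ i → T (adj spider (low i) (high i))
    edge i = subst₂ (λ a b → T (edgeᵇ Hangs a b))
                    (sym (toℕ-vertex (low≤N i))) (sym (toℕ-vertex (high≤N i)))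
      (edgeᵇ-up Hangs (toℕ i) (partner (toℕ i))
        (≤-<-trans (i≤k i) (k<partner (toℕ i)) , parent⇒hangs (parent-partner (toℕ i))))
    low-injective : ∀ {i j} → low i ≡ low j → i ≡ j
    low-injective {i} {j} e = toℕ-injective (vertex-injective (low≤N i) (low≤N j) e)
    high-injective : ∀ {i j} → high i ≡ high j → i ≡ j
    high-injective {i} {j} e = toℕ-injective (begin
      toℕ i                     ≡⟨ parent-partner (toℕ i) ⟨
      parent (partner (toℕ i))  ≡⟨ cong parent (vertex-injective (high≤N i) (high≤N j) e) ⟩
      parent (partner (toℕ j))  ≡⟨ parent-partner (toℕ j) ⟩
      toℕ j                     ∎)
      where open ≡-Reasoning
    apart : ∀ i j → low i ≢ high j
    apart i j e = <⇒≢ (≤-<-trans (i≤k i) (k<partner (toℕ j))) (vertex-injective (low≤N i) (high≤N j) e)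

*-^-distrib : ∀ m n o → (m * n) ^ o ≡ m ^ o * n ^ o
*-^-distrib m n zero    = refl
*-^-distrib m n (suc o) = begin
  (m * n) * (m * n) ^ o       ≡⟨ cong ((m * n) *_) (*-^-distrib m n o) ⟩
  (m * n) * (m ^ o * n ^ o)   ≡⟨ interchange m n (m ^ o) (n ^ o) ⟩
  (m * m ^ o) * (n * n ^ o)   ∎
  where open ≡-Reasoning

3k+1<3[k+1] : ∀ k → suc (k + k + k) < 3 * suc k
3k+1<3[k+1] k =
  subst (suc (k + k + k) <_) (sym (rearrange k)) (m<n+m (suc (k + k + k)) {2} (s≤s z≤n))
  where
  rearrange : ∀ k → 3 * suc k ≡ 2 + suc (k + k + k)
  rearrange = solve-∀

spider-ratio : ∀ a b k → 1 ≤ a → 1 ≤ b → a * suc (k + k + k) ^ b < a * 3 ^ b * suc k ^ b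
spider-ratio a@(suc _) b@(suc _) k _ _ = begin-strict
  a * suc (k + k + k) ^ b   <⟨ *-monoʳ-< a (^-monoˡ-< b (3k+1<3[k+1] k)) ⟩
  a * (3 * suc k) ^ b       ≡⟨ cong (a *_) (*-^-distrib 3 (suc k) b) ⟩
  a * (3 ^ b * suc k ^ b)   ≡⟨ *-assoc a (3 ^ b) (suc k ^ b) ⟨
  a * 3 ^ b * suc k ^ b     ∎
  where open ≤-Reasoning

mainTheorem17 : ∀ (a b : ℕ) → 1 ≤ a → 1 ≤ b →
    Σ ℕ λ n → Σ (Graph n) λ G → IsTree G × NoIsolatedVertices G ×
      Σ ℕ λ s → Σ ℕ λ ν → Sp G s × MatchingNumber G ν ×
        a * n ^ b < s * ν ^ b
mainTheorem17 a b a≥1 b≥1 =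
  suc N , spider , spider-tree , spider-no-isolated ,
  k , suc k , spider-sp , spider-matching , spider-ratio a b k a≥1 b≥1
  where
  k : ℕ
  k = a * 3 ^ b
  k≥1 : 1 ≤ k
  k≥1 = *-mono-≤ a≥1 (m^n>0 3 b)
  open Spider k k≥1
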